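{- Let $H$ be a $3$-uniform hypergraph on $n$ vertices, and let $K$ be a copy of $K_{2,2,2}$ in $H'$. Then $K$ contains a tight path of order $4$ or $5$ which is an $x$-absorber for every $x\in S_K$.
   Context: $\deg_H(u,v)$ is the number of edges of $H$ containing $u$ and $v$; $G_{1/3}=\{uv\colon \deg_H(u,v)\ge \frac13(n-2)\}$. $H'$ is the sub-$3$-graph of $H$ of all edges containing at least one pair from $G_{1/3}$. For a vertex $x$, $H'(x)=\{vw\colon\{x,v,w\}\in H'\}$ and $H(x)=\{vw\colon \{x,v,w\}\in H\}$ are link graphs, and $T^x$ is the $3$-graph of vertex sets of triangles of $H'(x)$. $K_{2,2,2}$ is the complete $3$-partite $3$-graph with classes of size $2$. A copy $K$ of $K_{2,2,2}$ is $x$-friendly if it is contained in the $3$-graph $T^x\cap H'$, and $S_K$ is the set of vertices $x$ for which $K$ is $x$-friendly. A tight path $v_1\dots v_i$ consists of edges $\{v_j,v_{j+1},v_{j+2}\}$, $1\le j\le i-2$; its order is $i$ and its endpairs are $v_1v_2$ and $v_iv_{i-1}$. An $x$-absorber of order $i$ is a tight path $P=v_1\dots v_i$ in $H$ such that the graph path $v_1v_2\cdots v_i$ is a subgraph of $H(x)$ and both endpairs $v_1v_2$ and $v_iv_{i-1}$ belong to $G_{1/3}$. -}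

module Defs where

open import Data.Nat using (ℕ; _≤_; _*_; _∸_)
open import Data.Bool using (Bool; true; false; if_then_else_)
open import Data.Fin using (Fin; zero; suc)
open import Data.List using (List; []; _∷_; map; allFin; reverse; length)
open import Data.Nat.ListAction using (sum)
open import Data.List.Relation.Unary.Unique.Propositional using (Unique)
open import Data.Product using (Σ; ∃; _×_; _,_)
open import Data.Sum using (_⊎_)
open import Data.Unit using (⊤)
open import Relation.Binary.PropositionalEquality using (_≡_; _≢_)

-- A 3-uniform hypergraph on vertex set Fin n, given by a symmetric
-- indicator of 3-element sets {u,v,w} (false whenever two arguments coincide).
record Hypergraph3 (n : ℕ) : Set where
  field
    edge     : Fin n → Fin n → Fin n → Bool
    sym12    : ∀ u v w → edge u v w ≡ edge v u w
    sym23    : ∀ u v w → edge u v w ≡ edge u w v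
    loopless : ∀ u w → edge u u w ≡ false
open Hypergraph3 public

module _ {n : ℕ} (H : Hypergraph3 n) where

  Edge : Fin n → Fin n → Fin n → Set
  Edge u v w = edge H u v w ≡ true

  deg : Fin n → Fin n → ℕ
  deg u v = sum (map (λ w → if edge H u v w then 1 else 0) (allFin n))

  G13 : Fin n → Fin n → Set
  G13 u v = u ≢ v × (n ∸ 2) ≤ 3 * deg u v

  Edge' : Fin n → Fin n → Fin n → Set
  Edge' u v w = Edge u v w × (G13 u v ⊎ G13 v w ⊎ G13 u w)

  Link : Fin n → Fin n → Fin n → Set
  Link x v w = Edge x v w

  Link' : Fin n → Fin n → Fin n → Set
  Link' x v w = Edge' x v w

  T : Fin n → Fin n → Fin n → Fin n → Set
  T x u v w = Link' x u v × Link' x v w × Link' x u w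

PermOf : {A : Set} → A → A → A → A → A → A → Set
PermOf u v w a b c =
    (u ≡ a × v ≡ b × w ≡ c) ⊎ (u ≡ a × v ≡ c × w ≡ b)
  ⊎ (u ≡ b × v ≡ a × w ≡ c) ⊎ (u ≡ b × v ≡ c × w ≡ a)
  ⊎ (u ≡ c × v ≡ a × w ≡ b) ⊎ (u ≡ c × v ≡ b × w ≡ a)

record K222 {n : ℕ} (H : Hypergraph3 n) : Set where
  field
    A B C    : Fin 2 → Fin n
    distinct : Unique (A zero ∷ A (suc zero) ∷ B zero ∷ B (suc zero) ∷ C zero ∷ C (suc zero) ∷ [])
    edges    : ∀ i j k → Edge' H (A i) (B j) (C k)
open K222 public

module _ {n : ℕ} {H : Hypergraph3 n} (K : K222 H) where

  KEdge : Fin n → Fin n → Fin n → Set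
  KEdge u v w = ∃ λ i → ∃ λ j → ∃ λ k → PermOf u v w (A K i) (B K j) (C K k)

  -- K is x-friendly: every edge of K lies in T^x ∩ H'  (x ∈ S_K)
  Friendly : Fin n → Set
  Friendly x = ∀ u v w → KEdge u v w → T H x u v w × Edge' H u v w

ConsecTriples : {A : Set} → (A → A → A → Set) → List A → Set
ConsecTriples P (a ∷ b ∷ c ∷ rest) = P a b c × ConsecTriples P (b ∷ c ∷ rest)
ConsecTriples P _ = ⊤

ConsecPairs : {A : Set} → (A → A → Set) → List A → Set
ConsecPairs P (a ∷ b ∷ rest) = P a b × ConsecPairs P (b ∷ rest)
ConsecPairs P _ = ⊤

StartPair : {A : Set} → (A → A → Set) → List A → Set
StartPair P (a ∷ b ∷ _) = P a b
StartPair P _ = Data.Empty.⊥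
  where import Data.Empty

TightPath : {A : Set} → (A → A → A → Set) → List A → Set
TightPath P vs = Unique vs × ConsecTriples P vs

-- x-absorber: tight path in H, graph path in H(x), both endpairs in G_{1/3}
-- (endpair v_i v_{i-1} is the start pair of the reversed sequence)
Absorber : {n : ℕ} → Hypergraph3 n → Fin n → List (Fin n) → Set
Absorber H x vs =
  TightPath (Edge H) vs × ConsecPairs (Link H x) vs
  × StartPair (G13 H) vs × StartPair (G13 H) (reverse vs)

module Submission where

-- Each of the two disjoint edges a₀b₀c₀ and a₁b₁c₁ of K lies in H', so each contains
-- a pair of G_{1/3}. If both pairs join the same two classes X, Y (third class Z), the
-- tight path x₀y₀z₀x₁y₁ has these pairs as endpairs; otherwise the pairs share exactly
-- one class W, say w₀u₀ and w₁v₁, and w₀u₀v₁w₁ does. Consecutive triples of such paths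
-- meet all three classes, so they are edges of K, and x-friendliness of K puts every
-- edge of K into H and each of its pairs into H(x): the path is an x-absorber for every
-- x ∈ S_K at once.

open import Defs
open import Data.Nat using (ℕ; _≤_; _*_; _∸_)
open import Data.Nat.ListAction using (sum)
open import Data.Bool using (if_then_else_)
open import Data.Empty using (⊥-elim)
open import Data.Fin using (Fin; zero; suc)
open import Data.Fin.Properties using (_≟_)
open import Data.List using (List; []; _∷_; length; map; reverse; allFin; cartesianProduct)
open import Data.List.Properties using (map-cong)
open import Data.List.Membership.Propositional using (_∈_)
open import Data.List.Membership.Propositional.Properties using (∈-map⁺; ∈-allFin; ∈-cartesianProduct⁺)
open import Data.List.Relation.Unary.All as All using ()
open import Data.List.Relation.Unary.Any using (here; there)
open import Data.List.Relation.Unary.AllPairs using (_∷_)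
open import Data.List.Relation.Unary.Unique.Propositional using (Unique)
open import Data.List.Relation.Unary.Unique.Propositional.Properties using (map⁺)
open import Data.Maybe using (Maybe; just; nothing; is-just; to-witness-T; _>>=_)
open import Data.Product using (∃; _×_; _,_; proj₁; proj₂)
open import Data.Product.Properties using (≡-dec)
open import Data.Sum using (_⊎_; inj₁; inj₂)
open import Data.Unit using (tt)
open import Relation.Nullary.Decidable using (True; toWitness)
open import Relation.Binary.PropositionalEquality using (_≡_; refl; sym; cong; subst)

import Data.Bool as Bool
import Data.List.Relation.Unary.Unique.DecPropositional as DecUnique

deg-sym : ∀ {n} (H : Hypergraph3 n) u v → deg H u v ≡ deg H v u
deg-sym {n} H u v =
  cong sum (map-cong (λ w → cong (λ b → if b then 1 else 0) (sym12 H u v w)) (allFin n))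

G13-sym : ∀ {n} (H : Hypergraph3 n) {u v} → G13 H u v → G13 H v u
G13-sym {n} H {u} {v} (u≢v , large) =
  (λ v≡u → u≢v (sym v≡u)) , subst (λ d → n ∸ 2 ≤ 3 * d) (deg-sym H u v) large

module _ {A : Set} {P Q : A → A → A → Set} where

  ConsecTriples-map : (∀ {a b c} → P a b c → Q a b c) →
                      ∀ xs → ConsecTriples P xs → ConsecTriples Q xs
  ConsecTriples-map f []                _        = tt
  ConsecTriples-map f (_ ∷ [])          _        = tt
  ConsecTriples-map f (_ ∷ _ ∷ [])      _        = tt
  ConsecTriples-map f (a ∷ b ∷ c ∷ xs) (t , ts) = f t , ConsecTriples-map f (b ∷ c ∷ xs) ts

module _ {A : Set} {P : A → A → A → Set} {Q : A → A → Set} where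

  ConsecTriples⇒ConsecPairs : (∀ {a b c} → P a b c → Q a b × Q b c) →
                              ∀ a b c xs → ConsecTriples P (a ∷ b ∷ c ∷ xs) →
                              ConsecPairs Q (a ∷ b ∷ c ∷ xs)
  ConsecTriples⇒ConsecPairs f a b c []       (t , _)  = proj₁ (f t) , proj₂ (f t) , tt
  ConsecTriples⇒ConsecPairs f a b c (d ∷ xs) (t , ts) =
    proj₁ (f t) , ConsecTriples⇒ConsecPairs f b c d xs ts

Unique-map⇒injectiveOn : ∀ {A B : Set} {f : A → B} {xs x y} →
                         Unique (map f xs) → x ∈ xs → y ∈ xs → f x ≡ f y → x ≡ y
Unique-map⇒injectiveOn _ (here refl) (here refl) _ = refl
Unique-map⇒injectiveOn {f = f} (fx∉ ∷ _) (here refl) (there y∈) fx≡fy =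
  ⊥-elim (All.lookup fx∉ (∈-map⁺ f y∈) fx≡fy)
Unique-map⇒injectiveOn {f = f} (fy∉ ∷ _) (there x∈) (here refl) fx≡fy =
  ⊥-elim (All.lookup fy∉ (∈-map⁺ f x∈) (sym fx≡fy))
Unique-map⇒injectiveOn (_ ∷ unique) (there x∈) (there y∈) fx≡fy =
  Unique-map⇒injectiveOn unique x∈ y∈ fx≡fy

module _ {n : ℕ} {H : Hypergraph3 n} (K : K222 H) where

  friendly⇒edge : ∀ {x u v w} → Friendly K x → KEdge K u v w → Edge H u v w
  friendly⇒edge friendly e = proj₁ (proj₂ (friendly _ _ _ e))

  friendly⇒links : ∀ {x u v w} → Friendly K x → KEdge K u v w →
                   Link H x u v × Link H x v w
  friendly⇒links friendly e with proj₁ (friendly _ _ _ e)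
  ... | (xuv , _) , (xvw , _) , _ = xuv , xvw

  AbsorbingPath : List (Fin n) → Set
  AbsorbingPath vs = TightPath (KEdge K) vs × (∀ x → Friendly K x → Absorber H x vs)

  tightPath⇒absorbingPath : ∀ a b c vs → let us = a ∷ b ∷ c ∷ vs in
    TightPath (KEdge K) us → StartPair (G13 H) us → StartPair (G13 H) (reverse us) →
    AbsorbingPath us
  tightPath⇒absorbingPath a b c vs path@(unique , triples) start end =
    path , λ x friendly →
      (unique , ConsecTriples-map (friendly⇒edge friendly) _ triples)
      , ConsecTriples⇒ConsecPairs (friendly⇒links friendly) a b c vs triples
      , start , end

  Position : Set
  Position = Fin 3 × Fin 2

  vertex : Position → Fin n
  vertex (zero , i)           = A K i
  vertex (suc zero , i)       = B K i
  vertex (suc (suc zero) , i) = C K i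

  -- `map vertex positions` evaluates to the list of six vertices that `distinct K` speaks about.
  vertex-injective : ∀ {p q} → vertex p ≡ vertex q → p ≡ q
  vertex-injective {p} {q} =
    Unique-map⇒injectiveOn {xs = positions} (distinct K) (∈-positions p) (∈-positions q)
    where
    positions : List Position
    positions = cartesianProduct (allFin 3) (allFin 2)
    ∈-positions : ∀ p → p ∈ positions
    ∈-positions (X , i) = ∈-cartesianProduct⁺ (∈-allFin X) (∈-allFin i)

  a₀ a₁ b₀ b₁ c₀ c₁ : Position
  a₀ = zero , zero
  a₁ = zero , suc zero
  b₀ = suc zero , zero
  b₁ = suc zero , suc zero
  c₀ = suc (suc zero) , zero
  c₁ = suc (suc zero) , suc zero

  transversal? : ∀ p q r → Maybe (KEdge K (vertex p) (vertex q) (vertex r))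
  transversal? (zero , i) (suc zero , j) (suc (suc zero) , k) =
    just (i , j , k , inj₁ (refl , refl , refl))
  transversal? (zero , i) (suc (suc zero) , k) (suc zero , j) =
    just (i , j , k , inj₂ (inj₁ (refl , refl , refl)))
  transversal? (suc zero , j) (zero , i) (suc (suc zero) , k) =
    just (i , j , k , inj₂ (inj₂ (inj₁ (refl , refl , refl))))
  transversal? (suc zero , j) (suc (suc zero) , k) (zero , i) =
    just (i , j , k , inj₂ (inj₂ (inj₂ (inj₁ (refl , refl , refl)))))
  transversal? (suc (suc zero) , k) (zero , i) (suc zero , j) =
    just (i , j , k , inj₂ (inj₂ (inj₂ (inj₂ (inj₁ (refl , refl , refl))))))
  transversal? (suc (suc zero) , k) (suc zero , j) (zero , i) =
    just (i , j , k , inj₂ (inj₂ (inj₂ (inj₂ (inj₂ (refl , refl , refl))))))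
  transversal? _ _ _ = nothing

  transversals? : ∀ ps → Maybe (ConsecTriples (KEdge K) (map vertex ps))
  transversals? []                = just tt
  transversals? (_ ∷ [])          = just tt
  transversals? (_ ∷ _ ∷ [])      = just tt
  transversals? (p ∷ q ∷ r ∷ ps) =
    transversal? p q r >>= λ e → transversals? (q ∷ r ∷ ps) >>= λ es → just (e , es)

  -- The distinctness and edge conditions on a concrete list of positions are
  -- discharged by evaluation: the implicit arguments then have type ⊤.
  absorbingPath : ∀ p q r ps → let us = map vertex (p ∷ q ∷ r ∷ ps) in
    {True (DecUnique.unique? (≡-dec _≟_ _≟_) (p ∷ q ∷ r ∷ ps))} →
    {Bool.T (is-just (transversals? (p ∷ q ∷ r ∷ ps)))} →
    StartPair (G13 H) us → StartPair (G13 H) (reverse us) → AbsorbingPath us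
  absorbingPath p q r ps {distinct} {transversal} =
    tightPath⇒absorbingPath (vertex p) (vertex q) (vertex r) (map vertex ps)
      ( map⁺ vertex-injective (toWitness distinct)
      , to-witness-T (transversals? (p ∷ q ∷ r ∷ ps)) transversal )

  absorbingPath-of-G13-pairs :
    G13 H (A K zero) (B K zero) ⊎ G13 H (B K zero) (C K zero) ⊎ G13 H (A K zero) (C K zero) →
    G13 H (A K (suc zero)) (B K (suc zero)) ⊎ G13 H (B K (suc zero)) (C K (suc zero))
      ⊎ G13 H (A K (suc zero)) (C K (suc zero)) →
    ∃ λ vs → (length vs ≡ 4 ⊎ length vs ≡ 5) × AbsorbingPath vs
  absorbingPath-of-G13-pairs (inj₁ ab) (inj₁ ab′) =
    _ , inj₂ refl , absorbingPath a₀ b₀ c₀ (a₁ ∷ b₁ ∷ []) ab (G13-sym H ab′)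
  absorbingPath-of-G13-pairs (inj₁ ab) (inj₂ (inj₁ bc′)) =
    _ , inj₁ refl , absorbingPath b₀ a₀ c₁ (b₁ ∷ []) (G13-sym H ab) bc′
  absorbingPath-of-G13-pairs (inj₁ ab) (inj₂ (inj₂ ac′)) =
    _ , inj₁ refl , absorbingPath a₀ b₀ c₁ (a₁ ∷ []) ab ac′
  absorbingPath-of-G13-pairs (inj₂ (inj₁ bc)) (inj₁ ab′) =
    _ , inj₁ refl , absorbingPath b₀ c₀ a₁ (b₁ ∷ []) bc (G13-sym H ab′)
  absorbingPath-of-G13-pairs (inj₂ (inj₁ bc)) (inj₂ (inj₁ bc′)) =
    _ , inj₂ refl , absorbingPath b₀ c₀ a₀ (b₁ ∷ c₁ ∷ []) bc (G13-sym H bc′)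
  absorbingPath-of-G13-pairs (inj₂ (inj₁ bc)) (inj₂ (inj₂ ac′)) =
    _ , inj₁ refl , absorbingPath c₀ b₀ a₁ (c₁ ∷ []) (G13-sym H bc) (G13-sym H ac′)
  absorbingPath-of-G13-pairs (inj₂ (inj₂ ac)) (inj₁ ab′) =
    _ , inj₁ refl , absorbingPath a₀ c₀ b₁ (a₁ ∷ []) ac ab′
  absorbingPath-of-G13-pairs (inj₂ (inj₂ ac)) (inj₂ (inj₁ bc′)) =
    _ , inj₁ refl , absorbingPath c₀ a₀ b₁ (c₁ ∷ []) (G13-sym H ac) (G13-sym H bc′)
  absorbingPath-of-G13-pairs (inj₂ (inj₂ ac)) (inj₂ (inj₂ ac′)) =
    _ , inj₂ refl , absorbingPath a₀ c₀ b₀ (a₁ ∷ c₁ ∷ []) ac (G13-sym H ac′)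

claim3p9 : (n : ℕ) (H : Hypergraph3 n) (K : K222 H) →
    ∃ λ (vs : List (Fin n)) →
      (length vs ≡ 4 ⊎ length vs ≡ 5)
      × TightPath (KEdge K) vs
      × (∀ x → Friendly K x → Absorber H x vs)
claim3p9 n H K =
  absorbingPath-of-G13-pairs K
    (proj₂ (edges K zero zero zero)) (proj₂ (edges K (suc zero) (suc zero) (suc zero)))
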